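{- Let $D$ be a digraph, $T$ a $(k-1,k-1)$-linked set of size $2k-1$ in $D$, and $X,Z\subseteq V(D)$. Then $Z$ is a hitting set of $\overline{\mathcal B_T}(X)$ if and only if $Z$ is a $(T\setminus X,k-1)$-balanced separator in $D\setminus X$.
   Context: A $(T,r)$-balanced separator in a digraph $H$ is a set $Z$ of vertices such that every strong component of $H\setminus Z$ contains at most $r$ vertices of $T$; $T$ is $(k',r)$-linked if every $(T,r)$-balanced separator has size at least $k'+1$. The $T$-bramble is $\mathcal B_T=\{B : B \text{ an induced strongly connected subgraph of } D,\ |V(B)\cap T|\ge k\}$. For $X\subseteq V(D)$, the complement bramble is $\overline{\mathcal B_T}(X)=\{B\in\mathcal B_T: V(B)\cap X=\emptyset\}$. A hitting set of a family of subgraphs is a vertex set meeting the vertex set of every member. -}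

module Defs where

open import Data.Nat using (ℕ; suc; _≤_; _≥_; _+_)
open import Data.Fin using (Fin)
open import Data.Fin.Subset using (Subset; _∈_; _∉_; _⊆_; _∩_; _─_; ∁; ∣_∣; Nonempty; ⊤)
open import Data.Product using (_×_; ∃)

record Digraph (n : ℕ) : Set₁ where
  field
    Arc : Fin n → Fin n → Set
open Digraph public

module _ {n : ℕ} (D : Digraph n) where

  data ReachIn (S : Subset n) : Fin n → Fin n → Set where
    here  : ∀ {u} → u ∈ S → ReachIn S u u
    step  : ∀ {u w v} → u ∈ S → Arc D u w → ReachIn S w v → ReachIn S u v

  StronglyConnected : Subset n → Set
  StronglyConnected S =
    Nonempty S × (∀ {u v} → u ∈ S → v ∈ S → ReachIn S u v)

  StrongComponentOf : Subset n → Subset n → Set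
  StrongComponentOf W C =
    C ⊆ W × StronglyConnected C ×
    (∀ C' → C ⊆ C' → C' ⊆ W → StronglyConnected C' → C' ⊆ C)

  -- Z is a (T,r)-balanced separator in H = D[W]: every strong component
  -- of H ∖ Z = D[W ∖ Z] contains at most r vertices of T.
  BalancedSeparator : (W T : Subset n) (r : ℕ) (Z : Subset n) → Set
  BalancedSeparator W T r Z =
    ∀ C → StrongComponentOf (W ─ Z) C → ∣ C ∩ T ∣ ≤ r

  Linked : (T : Subset n) (k' r : ℕ) → Set
  Linked T k' r = ∀ Z → BalancedSeparator ⊤ T r Z → ∣ Z ∣ ≥ k' + 1

  -- B (given by its vertex set; B is induced) is a member of the T-bramble.
  InTBramble : (T : Subset n) (k : ℕ) (B : Subset n) → Set
  InTBramble T k B = StronglyConnected B × ∣ B ∩ T ∣ ≥ k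

  InComplBramble : (T : Subset n) (k : ℕ) (X B : Subset n) → Set
  InComplBramble T k X B = InTBramble T k B × (∀ {v} → v ∈ B → v ∉ X)

  HittingSetComplBramble : (T : Subset n) (k : ℕ) (X Z : Subset n) → Set
  HittingSetComplBramble T k X Z =
    ∀ B → InComplBramble T k X B → ∃ λ v → v ∈ B × v ∈ Z

module Submission where

-- Write W = V(D) ∖ X.
--
--   (⇒) A strong component C of D[W ∖ Z] with more than r vertices of
--       T ∖ X is strongly connected, avoids X and has at least k
--       vertices of T, so it lies in the complement bramble; a hitting
--       vertex of Z in C is impossible since C avoids Z.
--   (⇐) If a member B of the complement bramble missed Z, then B would
--       be a strongly connected subset of W ∖ Z and hence would lie in a
--       strong component C of D[W ∖ Z]; C would then contain all
--       |B ∩ T| ≥ r + 1 vertices of B ∩ T, all outside X, contradicting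
--       the separator bound.  Whether B meets Z is decidable, so the
--       contradiction yields a hitting vertex.
--
-- The one graph-theoretic ingredient of (⇐), that a strongly connected
-- set extends to a strong component, is proved first by enlarging it
-- until it is maximal, by well-founded recursion on its co-size.  As
-- strong connectivity is not decidable in this setting, that lemma is
-- stated in double-negated form, which suffices for a decidable goal.

open import Defs
open import Data.Nat using (ℕ; _≤_; _<_; _∸_; _*_; suc; s≤s; z≤n)
open import Data.Nat.Properties using (≤-trans; <-irrefl; <-≤-trans; ≰⇒>; _≤?_; ∸-monoʳ-<)
open import Data.Nat.Induction using (<-wellFounded)
open import Induction.WellFounded using (Acc; acc)
open import Data.Fin using (Fin)
open import Data.Fin.Subset using (Subset; ∣_∣; _─_; ⊤; _∈_; _∉_; _⊆_; _⊂_; _∩_; outside; inside)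
open import Data.Fin.Subset.Properties
  using (_∈?_; _⊂?_; p⊂q⇒∣p∣<∣q∣; ∣p∣≤n; p⊆q⇒∣p∣≤∣q∣; x∈p∩q⁺; x∈p∩q⁻; x∈p∧x∉q⇒x∈p─q; p─q⊆p; nonempty?; ∈⊤)
open import Data.Product using (_×_; _,_; ∃)
open import Data.Vec using (_∷_)
open import Data.Vec.Base using (there)
open import Data.Empty using (⊥-elim)
open import Relation.Nullary using (¬_; yes; no)
open import Function.Bundles using (_⇔_; mk⇔)
open import Relation.Binary.PropositionalEquality using (_≡_; refl)

x∈p─q⇒x∉q : ∀ {n} {x : Fin n} (p q : Subset n) → x ∈ p ─ q → x ∉ q
x∈p─q⇒x∉q (_ ∷ p) (outside ∷ q) (there x∈p─q) (there x∈q) = x∈p─q⇒x∉q p q x∈p─q x∈q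
x∈p─q⇒x∉q (_ ∷ p) (inside  ∷ q) (there x∈p─q) (there x∈q) = x∈p─q⇒x∉q p q x∈p─q x∈q

⊆∧⊄⇒⊇ : ∀ {n} {p q : Subset n} → p ⊆ q → ¬ (p ⊂ q) → q ⊆ p
⊆∧⊄⇒⊇ {p = p} p⊆q p⊄q {x} x∈q with x ∈? p
... | yes x∈p = x∈p
... | no  x∉p = ⊥-elim (p⊄q (p⊆q , x , x∈q , x∉p))

∩─⊆∩ : ∀ {n} (C T X : Subset n) → C ∩ (T ─ X) ⊆ C ∩ T
∩─⊆∩ C T X x∈ with x∈p∩q⁻ C (T ─ X) x∈
... | x∈C , x∈T─X = x∈p∩q⁺ (x∈C , p─q⊆p T X x∈T─X)

module _ {n : ℕ} (D : Digraph n) (W : Subset n) where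

  -- If C is not maximal, a strictly larger
  -- strongly connected C' ⊆ W has smaller co-size n ∸ ∣ C' ∣; recurse.
  extendToComponent : ∀ C → C ⊆ W → StronglyConnected D C
    → ¬ ¬ (∃ λ K → StrongComponentOf D W K × C ⊆ K)
  extendToComponent C = grow C (<-wellFounded (n ∸ ∣ C ∣))
    where
    grow : ∀ C → Acc _<_ (n ∸ ∣ C ∣) → C ⊆ W → StronglyConnected D C
      → ¬ ¬ (∃ λ K → StrongComponentOf D W K × C ⊆ K)
    grow C (acc smaller) C⊆W scC noComponent =
      noComponent (C , (C⊆W , scC , maximal) , λ x∈C → x∈C)
      where
      maximal : ∀ C' → C ⊆ C' → C' ⊆ W → StronglyConnected D C' → C' ⊆ C
      maximal C' C⊆C' C'⊆W scC' with C ⊂? C'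
      ... | no  C⊄C' = ⊆∧⊄⇒⊇ C⊆C' C⊄C'
      ... | yes C⊂C' = ⊥-elim (grow C' (smaller coSizeDrops) C'⊆W scC'
              λ { (K , K-comp , C'⊆K) → noComponent (K , K-comp , λ x∈C → C'⊆K (C⊆C' x∈C)) })
        where
        coSizeDrops : n ∸ ∣ C' ∣ < n ∸ ∣ C ∣
        coSizeDrops = ∸-monoʳ-< (p⊂q⇒∣p∣<∣q∣ C⊂C') (∣p∣≤n C')

module _ {n : ℕ} (D : Digraph n) (T X Z : Subset n) (r : ℕ) where

  -- (⇒) A strong component of D[(V ∖ X) ∖ Z] carrying more than r
  -- vertices of T ∖ X is a member of the complement bramble missing Z.
  hitting⇒balanced : HittingSetComplBramble D T (suc r) X Z
    → BalancedSeparator D (⊤ ─ X) (T ─ X) r Z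
  hitting⇒balanced hit C (C⊆W─Z , scC , _) with ∣ C ∩ (T ─ X) ∣ ≤? r
  ... | yes small = small
  ... | no  large with hit C ((scC , manyT) , avoidsX)
    where
    manyT : suc r ≤ ∣ C ∩ T ∣
    manyT = ≤-trans (≰⇒> large) (p⊆q⇒∣p∣≤∣q∣ (∩─⊆∩ C T X))
    avoidsX : ∀ {v} → v ∈ C → v ∉ X
    avoidsX v∈C = x∈p─q⇒x∉q ⊤ X (p─q⊆p (⊤ ─ X) Z (C⊆W─Z v∈C))
  ... | v , v∈C , v∈Z = ⊥-elim (x∈p─q⇒x∉q (⊤ ─ X) Z (C⊆W─Z v∈C) v∈Z)

  -- (⇐) A bramble member B avoiding X and Z lies in a strong component
  -- of D[(V ∖ X) ∖ Z], which then holds at least r + 1 vertices of T ∖ X.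
  balanced⇒hitting : BalancedSeparator D (⊤ ─ X) (T ─ X) r Z
    → HittingSetComplBramble D T (suc r) X Z
  balanced⇒hitting separator B ((scB , manyT) , avoidsX) with nonempty? (B ∩ Z)
  ... | yes (v , v∈B∩Z) = v , x∈p∩q⁻ B Z v∈B∩Z
  ... | no  B∩Z-empty = ⊥-elim (extendToComponent D ((⊤ ─ X) ─ Z) B B⊆W─Z scB tooManyT)
    where
    B⊆W─Z : B ⊆ (⊤ ─ X) ─ Z
    B⊆W─Z v∈B = x∈p∧x∉q⇒x∈p─q (x∈p∧x∉q⇒x∈p─q ∈⊤ (avoidsX v∈B))
                  (λ v∈Z → B∩Z-empty (_ , x∈p∩q⁺ (v∈B , v∈Z)))
    tooManyT : ¬ (∃ λ K → StrongComponentOf D ((⊤ ─ X) ─ Z) K × B ⊆ K)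
    tooManyT (K , K-comp , B⊆K) =
      <-irrefl refl (<-≤-trans (s≤s (separator K K-comp)) (≤-trans manyT (p⊆q⇒∣p∣≤∣q∣ B∩T⊆K∩T─X)))
      where
      B∩T⊆K∩T─X : B ∩ T ⊆ K ∩ (T ─ X)
      B∩T⊆K∩T─X v∈B∩T with x∈p∩q⁻ B T v∈B∩T
      ... | v∈B , v∈T = x∈p∩q⁺ (B⊆K v∈B , x∈p∧x∉q⇒x∈p─q v∈T (avoidsX v∈B))

-- Theorem 10.
mainTheorem10 : ∀ {n : ℕ} (D : Digraph n) (k : ℕ) (T X Z : Subset n)
    → 1 ≤ k
    → ∣ T ∣ ≡ 2 * k ∸ 1
    → Linked D T (k ∸ 1) (k ∸ 1)
    → HittingSetComplBramble D T k X Z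
      ⇔ BalancedSeparator D (⊤ ─ X) (T ─ X) (k ∸ 1) Z
mainTheorem10 D (suc r) T X Z (s≤s z≤n) _ _ =
  mk⇔ (hitting⇒balanced D T X Z r) (balanced⇒hitting D T X Z r)
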